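{- Let $m\ge2$, $g\ge0$, $n=m+g(m-1)$, and let $t$ be an $m$-ary tree with $n$ leaves and depth $(\delta^{l_1}(t),\dots,\delta^{l_m}(t))$. Then $\sigma_m(t)=N^{d_1}SN^{d_2}S\dots SN^{d_{n-1}}SN^{d_n}$, where $$d_1=(m-1)\delta^{l_1}_1(t),\qquad d_j=\Big(\sum_{i=1}^{m}(m-i)\big(\delta^{l_i}_j(t)-\delta^{l_i}_{j-1}(t)\big)\Big)+1\quad(2\le j\le n).$$
   Context: An $m$-ary tree is a rooted tree in which each node has either $0$ or $m$ linearly ordered children; leaves are numbered $1,\dots,n$ from left to right; each edge joining a node to its $i$-th child is labelled $l_i$; $\delta^{l_i}_j(t)$ is the number of edges labelled $l_i$ on the path from the root to leaf $j$, $\delta^{l_i}(t)=(\delta^{l_i}_1(t),\dots,\delta^{l_i}_n(t))$, and the depth of $t$ is $(\delta^{l_1}(t),\dots,\delta^{l_m}(t))$. $t_1\wedge\dots\wedge t_m$ is the tree whose root has $t_i$ as subtree at its $i$-th child. $N$ denotes the unit step $(1,1)$, $S$ the step $(1,-1)$, and $N^{d}$ is $d$ consecutive $N$'s. $\sigma_m(\varepsilon)$ is the empty word for the one-node tree $\varepsilon$, and $\sigma_m(t_1\wedge\dots\wedge t_m)=N^{m-1}\sigma_m(t_1)S\sigma_m(t_2)S\dots S\sigma_m(t_m)$. -}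

module Defs where

open import Data.Nat using (ℕ; zero; suc; _+_; _*_; _∸_; _≤_; _≟_)
open import Data.Integer as ℤ using (ℤ; +_)
open import Data.List using (List; []; _∷_; _++_; map; length; replicate)
open import Data.Vec using (Vec; []; _∷_)
open import Relation.Nullary using (yes; no)

data Tree (m : ℕ) : Set where
  leaf : Tree m
  node : Vec (Tree m) m → Tree m

-- Lattice-path steps: N = (1,1), S = (1,-1).
data Step : Set where
  N S : Step

Word : Set
Word = List Step

N^ : ℕ → Word
N^ d = replicate d N

mutual
  σ : {m : ℕ} → Tree m → Word
  σ leaf = []
  σ {m} (node cs) = N^ (m ∸ 1) ++ σs cs

  σs : {m k : ℕ} → Vec (Tree m) k → Word
  σs [] = []
  σs (t ∷ []) = σ t
  σs (t ∷ u ∷ ts) = σ t ++ (S ∷ σs (u ∷ ts))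

-- Label sequences of the root-to-leaf paths, leaves ordered left to right.
-- The label l_i (edge to the i-th child) is encoded by the number i ∸ 1.
mutual
  paths : {m : ℕ} → Tree m → List (List ℕ)
  paths leaf = [] ∷ []
  paths (node cs) = pathsV 0 cs

  pathsV : {m k : ℕ} → ℕ → Vec (Tree m) k → List (List ℕ)
  pathsV i [] = []
  pathsV i (c ∷ cs) = map (i ∷_) (paths c) ++ pathsV (suc i) cs

leaves : {m : ℕ} → Tree m → ℕ
leaves t = length (paths t)

count : ℕ → List ℕ → ℕ
count x [] = 0
count x (y ∷ ys) with x ≟ y
... | yes _ = suc (count x ys)
... | no _ = count x ys

-- 1-based lookup with default (only used for 1 ≤ j ≤ length)
nth : {A : Set} → A → List A → ℕ → A
nth d [] j = d
nth d (x ∷ xs) zero = d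
nth d (x ∷ xs) (suc zero) = x
nth d (x ∷ xs) (suc (suc j)) = nth d xs (suc j)

-- δ^{l_i}_j(t) : number of edges labelled l_i on the path from the root to leaf j
-- (i and j are 1-based)
δ : {m : ℕ} → Tree m → (i j : ℕ) → ℕ
δ t i j = count (i ∸ 1) (nth [] (paths t) j)

sumTo : ℕ → (ℕ → ℤ) → ℤ
sumTo zero f = + 0
sumTo (suc k) f = sumTo k f ℤ.+ f (suc k)

d₁ : {m : ℕ} → Tree m → ℤ
d₁ {m} t = + ((m ∸ 1) * δ t 1 1)

dⱼ : {m : ℕ} → Tree m → ℕ → ℤ
dⱼ {m} t j = sumTo m (λ i → (+ (m ∸ i)) ℤ.* ((+ δ t i j) ℤ.- (+ δ t i (j ∸ 1)))) ℤ.+ + 1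

pathWord : List ℕ → Word
pathWord [] = []
pathWord (d ∷ []) = N^ d
pathWord (d ∷ e ∷ ds) = N^ d ++ (S ∷ pathWord (e ∷ ds))

-- Give an edge labelled l_i the weight m − i and let W(p) be the weight of a root-to-leaf
-- path p. The height of the lattice path σ_m(t) just before its j-th S (at its end, for
-- j = n) is W(p_j); as the word between two such points is S N^{d_j}, this gives
-- d_j = W(p_j) − W(p_{j−1}) + 1, and d_1 = W(p_1) = (m−1)δ^{l_1}_1 because the leftmost
-- path uses only l_1. The invariant is proved by induction on t: prefixing a label adds
-- the same weight to all paths of a subtree, and at the junction of two sibling subtrees
-- the rightmost path of the left one (only l_m, weight 0) meets the leftmost path of the
-- right one, whose weight is the first run of that subtree.
module Submission where

open import Defs
open import Data.Nat using (ℕ; _+_; _*_; _∸_; _≤_)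
open import Data.Integer using (+_)
open import Data.List using (List; length)
open import Data.Product using (Σ; _×_)
open import Relation.Binary.PropositionalEquality using (_≡_)

open import Data.Nat using (zero; suc; _<_; _<?_; _≟_; s≤s)
open import Data.Nat.Properties
  using ( ≤-refl; ≤-pred; ≤∧≢⇒<; <⇒≤; <⇒≢; n∸n≡0; m≤n⇒m∸n≡0; m≤n+m; ≮⇒≥; m≤n⇒m≤1+n
        ; +-suc; *-suc; *-zeroʳ; +-assoc; +-identityʳ; +-commutativeSemigroup)
open import Algebra.Properties.CommutativeSemigroup +-commutativeSemigroup using (x∙yz≈y∙xz)
import Data.Nat.Tactic.RingSolver as ℕ-Solver
import Data.Integer as ℤ
open import Data.Integer.Properties using (pos-+; pos-*)
import Data.Integer.Tactic.RingSolver as ℤ-Solver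
open import Data.List using ([]; _∷_; _++_; map)
open import Data.List.Properties using (++-assoc; ++-identityʳ)
open import Data.List.NonEmpty using (List⁺; _∷_; head; tail; toList; _⁺++⁺_)
open import Data.Vec using (Vec; []; _∷_)
open import Data.Product using (_,_)
open import Data.Empty using (⊥-elim)
open import Function using (id)
open import Relation.Binary.PropositionalEquality using (_≢_; refl; sym; trans; cong; cong₂; subst; module ≡-Reasoning)
open import Relation.Nullary using (yes; no)

N^-++-N^ : ∀ a b → N^ a ++ N^ b ≡ N^ (a + b)
N^-++-N^ zero    b = refl
N^-++-N^ (suc a) b = cong (N ∷_) (N^-++-N^ a b)

N^-++-pathWord : ∀ a d ds → N^ a ++ pathWord (d ∷ ds) ≡ pathWord ((a + d) ∷ ds)
N^-++-pathWord a d []       = N^-++-N^ a d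
N^-++-pathWord a d (e ∷ es) = begin
  N^ a ++ (N^ d ++ S ∷ pathWord (e ∷ es))  ≡⟨ ++-assoc (N^ a) (N^ d) _ ⟨
  (N^ a ++ N^ d) ++ S ∷ pathWord (e ∷ es)  ≡⟨ cong (_++ _) (N^-++-N^ a d) ⟩
  N^ (a + d) ++ S ∷ pathWord (e ∷ es)      ∎
  where open ≡-Reasoning

pathWord-++ : ∀ x xs y ys → pathWord ((x ∷ xs) ++ y ∷ ys) ≡ pathWord (x ∷ xs) ++ S ∷ pathWord (y ∷ ys)
pathWord-++ x []        y ys = refl
pathWord-++ x (x′ ∷ xs) y ys = begin
  N^ x ++ S ∷ pathWord ((x′ ∷ xs) ++ y ∷ ys)                  ≡⟨ cong (λ w → N^ x ++ S ∷ w) (pathWord-++ x′ xs y ys) ⟩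
  N^ x ++ S ∷ (pathWord (x′ ∷ xs) ++ S ∷ pathWord (y ∷ ys))  ≡⟨ ++-assoc (N^ x) (S ∷ pathWord (x′ ∷ xs)) _ ⟨
  (N^ x ++ S ∷ pathWord (x′ ∷ xs)) ++ S ∷ pathWord (y ∷ ys)  ∎
  where open ≡-Reasoning

n<m⇒m∸n≡suc[m∸suc[n]] : ∀ {m n} → n < m → m ∸ n ≡ suc (m ∸ suc n)
n<m⇒m∸n≡suc[m∸suc[n]] {suc m} {zero}  _         = refl
n<m⇒m∸n≡suc[m∸suc[n]] {suc m} {suc n} (s≤s n<m) = n<m⇒m∸n≡suc[m∸suc[n]] n<m

count-∷-≢ : ∀ {x y} p → x ≢ y → count x (y ∷ p) ≡ count x p
count-∷-≢ {x} {y} p x≢y with x ≟ y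
... | yes x≡y = ⊥-elim (x≢y x≡y)
... | no _    = refl

weightedCount : (ℕ → ℕ) → ℕ → List ℕ → ℕ
weightedCount c zero    p = 0
weightedCount c (suc k) p = weightedCount c k p + c (suc k) * count k p

weightedCount-[] : ∀ c k → weightedCount c k [] ≡ 0
weightedCount-[] c zero    = refl
weightedCount-[] c (suc k) = cong₂ _+_ (weightedCount-[] c k) (*-zeroʳ (c (suc k)))

weightedCount-∷-≥ : ∀ c {k x} p → k ≤ x → weightedCount c k (x ∷ p) ≡ weightedCount c k p
weightedCount-∷-≥ c {zero}  p _   = refl
weightedCount-∷-≥ c {suc k} p k<x =
  cong₂ _+_ (weightedCount-∷-≥ c p (<⇒≤ k<x)) (cong (c (suc k) *_) (count-∷-≢ p (<⇒≢ k<x)))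

weightedCount-∷-< : ∀ c {k x} p → x < k → weightedCount c k (x ∷ p) ≡ c (suc x) + weightedCount c k p
weightedCount-∷-< c {suc k} {x} p x<k with k ≟ x
... | yes refl = begin
  weightedCount c k (k ∷ p) + c (suc k) * suc (count k p)    ≡⟨ cong₂ _+_ (weightedCount-∷-≥ c {k} p ≤-refl) (*-suc (c (suc k)) _) ⟩
  weightedCount c k p + (c (suc k) + c (suc k) * count k p)  ≡⟨ x∙yz≈y∙xz (weightedCount c k p) (c (suc k)) _ ⟩
  c (suc k) + (weightedCount c k p + c (suc k) * count k p)  ∎
  where open ≡-Reasoning
... | no k≢x = begin
  weightedCount c k (x ∷ p) + c (suc k) * count k p          ≡⟨ cong (_+ _) (weightedCount-∷-< c p x<k′) ⟩
  (c (suc x) + weightedCount c k p) + c (suc k) * count k p  ≡⟨ +-assoc (c (suc x)) _ _ ⟩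
  c (suc x) + (weightedCount c k p + c (suc k) * count k p)  ∎
  where
  open ≡-Reasoning
  x<k′ : x < k
  x<k′ = ≤∧≢⇒< (≤-pred x<k) (λ x≡k → k≢x (sym x≡k))

sumTo-weightedCount : ∀ c k a b →
  sumTo k (λ i → + c i ℤ.* (+ count (i ∸ 1) a ℤ.- + count (i ∸ 1) b))
    ≡ + weightedCount c k a ℤ.- + weightedCount c k b
sumTo-weightedCount c zero    a b = refl
sumTo-weightedCount c (suc k) a b = begin
    sumTo k f ℤ.+ f (suc k)
  ≡⟨ cong (ℤ._+ f (suc k)) (sumTo-weightedCount c k a b) ⟩
    (+ weightedCount c k a ℤ.- + weightedCount c k b) ℤ.+ + c (suc k) ℤ.* (+ count k a ℤ.- + count k b)
  ≡⟨ regroup (+ weightedCount c k a) (+ weightedCount c k b) (+ c (suc k)) (+ count k a) (+ count k b) ⟩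
    (+ weightedCount c k a ℤ.+ + c (suc k) ℤ.* + count k a) ℤ.- (+ weightedCount c k b ℤ.+ + c (suc k) ℤ.* + count k b)
  ≡⟨ cong₂ ℤ._-_ (pos-weightedCount-suc a) (pos-weightedCount-suc b) ⟨
    + weightedCount c (suc k) a ℤ.- + weightedCount c (suc k) b
  ∎
  where
  open ≡-Reasoning
  f : ℕ → ℤ.ℤ
  f i = + c i ℤ.* (+ count (i ∸ 1) a ℤ.- + count (i ∸ 1) b)
  regroup : ∀ u v w x y → (u ℤ.- v) ℤ.+ w ℤ.* (x ℤ.- y) ≡ (u ℤ.+ w ℤ.* x) ℤ.- (v ℤ.+ w ℤ.* y)
  regroup = ℤ-Solver.solve-∀
  pos-weightedCount-suc : ∀ p → + weightedCount c (suc k) p ≡ + weightedCount c k p ℤ.+ + c (suc k) ℤ.* + count k p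
  pos-weightedCount-suc p = trans (pos-+ (weightedCount c k p) (c (suc k) * count k p))
    (cong (λ z → + weightedCount c k p ℤ.+ z) (pos-* (c (suc k)) (count k p)))

m+n≡o+1⇒m≡o-n+1 : ∀ {d a b} → d + a ≡ b + 1 → + d ≡ (+ b ℤ.- + a) ℤ.+ + 1
m+n≡o+1⇒m≡o-n+1 {d} {a} {b} d+a≡b+1 = begin
  + d                              ≡⟨ add-sub (+ d) (+ a) ⟩
  (+ d ℤ.+ + a) ℤ.- + a            ≡⟨ cong (ℤ._- + a) (pos-+ d a) ⟨
  + (d + a) ℤ.- + a                ≡⟨ cong (λ n → + n ℤ.- + a) d+a≡b+1 ⟩
  + (b + 1) ℤ.- + a                ≡⟨ cong (ℤ._- + a) (pos-+ b 1) ⟩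
  (+ b ℤ.+ + 1) ℤ.- + a            ≡⟨ sub-comm (+ b) (+ a) ⟩
  (+ b ℤ.- + a) ℤ.+ + 1            ∎
  where
  open ≡-Reasoning
  add-sub : ∀ x y → x ≡ (x ℤ.+ y) ℤ.- y
  add-sub = ℤ-Solver.solve-∀
  sub-comm : ∀ x y → (x ℤ.+ + 1) ℤ.- y ≡ (x ℤ.- y) ℤ.+ + 1
  sub-comm = ℤ-Solver.solve-∀

module _ (m′ : ℕ) where
  private
    m : ℕ
    m = suc m′

  weight : List ℕ → ℕ
  weight = weightedCount (m ∸_) m

  weight-∷ : ∀ x p → weight (x ∷ p) ≡ (m ∸ suc x) + weight p
  weight-∷ x p with x <? m
  ... | yes x<m = weightedCount-∷-< (m ∸_) p x<m
  ... | no x≮m  = begin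
    weight (x ∷ p)          ≡⟨ weightedCount-∷-≥ (m ∸_) p (≮⇒≥ x≮m) ⟩
    weight p                ≡⟨ cong (_+ weight p) (m≤n⇒m∸n≡0 (m≤n⇒m≤1+n (≮⇒≥ x≮m))) ⟨
    (m ∸ suc x) + weight p  ∎
    where open ≡-Reasoning

  weight-junction : ∀ i q r → suc (suc i) ≤ m → weight r ≡ 0 →
    weight q + weight (i ∷ r) ≡ weight (suc i ∷ q) + 1
  weight-junction i q r 2+i≤m weight-r≡0 = begin
    weight q + weight (i ∷ r)                    ≡⟨ cong (λ w → weight q + w) (weight-∷ i r) ⟩
    weight q + ((m ∸ suc i) + weight r)          ≡⟨ cong₂ (λ a b → weight q + (a + b)) (n<m⇒m∸n≡suc[m∸suc[n]] 2+i≤m) weight-r≡0 ⟩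
    weight q + (suc (m ∸ suc (suc i)) + 0)       ≡⟨ regroup (weight q) (m ∸ suc (suc i)) ⟩
    ((m ∸ suc (suc i)) + weight q) + 1           ≡⟨ cong (_+ 1) (weight-∷ (suc i) q) ⟨
    weight (suc i ∷ q) + 1                       ∎
    where
    open ≡-Reasoning
    regroup : ∀ a b → a + (suc b + 0) ≡ (b + a) + 1
    regroup = ℕ-Solver.solve-∀

  data Steps : List ℕ → List ℕ → List (List ℕ) → List ℕ → Set where
    []  : ∀ {q} → Steps q [] [] q
    _∷_ : ∀ {q d ds p P r} → d + weight q ≡ weight p + 1 → Steps p ds P r → Steps q (d ∷ ds) (p ∷ P) r

  Steps-++ : ∀ {q ds P r es Q s} → Steps q ds P r → Steps r es Q s → Steps q (ds ++ es) (P ++ Q) s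
  Steps-++ []        s₂ = s₂
  Steps-++ (e ∷ s₁) s₂ = e ∷ Steps-++ s₁ s₂

  Steps-length : ∀ {q ds P r} → Steps q ds P r → length ds ≡ length P
  Steps-length []      = refl
  Steps-length (_ ∷ s) = cong suc (Steps-length s)

  Steps-nth : ∀ {q ds P r} → Steps q ds P r → ∀ j → j < length ds →
    nth 0 ds (suc j) + weight (nth [] (q ∷ P) (suc j)) ≡ weight (nth [] P (suc j)) + 1
  Steps-nth (e ∷ s) zero    _         = e
  Steps-nth (e ∷ s) (suc j) (s≤s j<n) = Steps-nth s j j<n

  Steps-map-∷ : ∀ x {q ds P r} → Steps q ds P r → Steps (x ∷ q) ds (map (x ∷_) P) (x ∷ r)
  Steps-map-∷ x []                               = []
  Steps-map-∷ x {q} (_∷_ {d = d} {p = p} e s) = step ∷ Steps-map-∷ x s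
    where
    open ≡-Reasoning
    step : d + weight (x ∷ q) ≡ weight (x ∷ p) + 1
    step = begin
      d + weight (x ∷ q)                ≡⟨ cong (λ w → d + w) (weight-∷ x q) ⟩
      d + ((m ∸ suc x) + weight q)      ≡⟨ x∙yz≈y∙xz d (m ∸ suc x) (weight q) ⟩
      (m ∸ suc x) + (d + weight q)      ≡⟨ cong (λ w → (m ∸ suc x) + w) e ⟩
      (m ∸ suc x) + (weight p + 1)      ≡⟨ +-assoc (m ∸ suc x) (weight p) 1 ⟨
      ((m ∸ suc x) + weight p) + 1      ≡⟨ cong (_+ 1) (weight-∷ x p) ⟨
      weight (x ∷ p) + 1                ∎

  mutual
    runs : Tree m → List⁺ ℕ
    runs leaf      = 0 ∷ []
    runs (node cs) = (m′ + head (runsV cs)) ∷ tail (runsV cs)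

    runsV : ∀ {k} → Vec (Tree m) (suc k) → List⁺ ℕ
    runsV (c ∷ [])     = runs c
    runsV (c ∷ u ∷ ts) = runs c ⁺++⁺ runsV (u ∷ ts)

  mutual
    σ-runs : ∀ t → σ t ≡ pathWord (toList (runs t))
    σ-runs leaf      = refl
    σ-runs (node cs) = trans (cong (N^ m′ ++_) (σs-runsV cs)) (N^-++-pathWord m′ (head (runsV cs)) (tail (runsV cs)))

    σs-runsV : ∀ {k} (cs : Vec (Tree m) (suc k)) → σs cs ≡ pathWord (toList (runsV cs))
    σs-runsV (c ∷ [])     = σ-runs c
    σs-runsV (c ∷ u ∷ ts) =
      trans (cong₂ (λ v w → v ++ S ∷ w) (σ-runs c) (σs-runsV (u ∷ ts)))
        (sym (pathWord-++ (head (runs c)) (tail (runs c)) (head (runsV (u ∷ ts))) (tail (runsV (u ∷ ts)))))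

  -- label prepends the edge labels above the subtree considered: id for a whole tree,
  -- (i ∷_) for the children of a node from the i-th one on.
  record RunsMatch (ds : List⁺ ℕ) (label : List ℕ → List ℕ) (P : List (List ℕ)) : Set where
    field
      first       : List ℕ
      rest        : List (List ℕ)
      last        : List ℕ
      P≡          : P ≡ label first ∷ rest
      head≡weight : head ds ≡ weight first
      head≡count  : head ds ≡ m′ * count 0 first
      steps       : Steps (label first) (tail ds) rest last
      weight-last : weight last ≡ 0

  RunsMatch-leaf : RunsMatch (0 ∷ []) id ([] ∷ [])
  RunsMatch-leaf = record
    { first = []; rest = []; last = []; P≡ = refl
    ; head≡weight = sym (weightedCount-[] (m ∸_) m)
    ; head≡count  = sym (*-zeroʳ m′)
    ; steps = []; weight-last = weightedCount-[] (m ∸_) m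
    }

  RunsMatch-node : ∀ {ds P} → RunsMatch ds (0 ∷_) P → RunsMatch ((m′ + head ds) ∷ tail ds) id P
  RunsMatch-node R = record
    { first = 0 ∷ first; rest = rest; last = last; P≡ = P≡
    ; head≡weight = trans (cong (λ h → m′ + h) head≡weight) (sym (weight-∷ 0 first))
    ; head≡count  = trans (cong (λ h → m′ + h) head≡count) (sym (*-suc m′ (count 0 first)))
    ; steps = steps; weight-last = weight-last
    }
    where open RunsMatch R

  RunsMatch-lastChild : ∀ {ds P} i → suc i ≡ m → RunsMatch ds id P → RunsMatch ds (i ∷_) (map (i ∷_) P ++ [])
  RunsMatch-lastChild {ds} i 1+i≡m R = record
    { first = first; rest = map (i ∷_) rest ++ []; last = i ∷ last
    ; P≡ = cong (λ P → map (i ∷_) P ++ []) P≡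
    ; head≡weight = head≡weight; head≡count = head≡count
    ; steps = subst (λ P → Steps (i ∷ first) (tail ds) P (i ∷ last))
                (sym (++-identityʳ (map (i ∷_) rest))) (Steps-map-∷ i steps)
    ; weight-last = trans (weight-∷ i last)
        (cong₂ _+_ (subst (λ n → n ∸ suc i ≡ 0) 1+i≡m (n∸n≡0 (suc i))) weight-last)
    }
    where open RunsMatch R

  RunsMatch-⁺++⁺ : ∀ {ds es P Q} i → suc (suc i) ≤ m → RunsMatch ds id P → RunsMatch es (suc i ∷_) Q →
    RunsMatch (ds ⁺++⁺ es) (i ∷_) (map (i ∷_) P ++ Q)
  RunsMatch-⁺++⁺ {es = es} i 2+i≤m R R′ = record
    { first = R.first; rest = map (i ∷_) R.rest ++ (suc i ∷ R′.first) ∷ R′.rest; last = R′.last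
    ; P≡ = cong₂ (λ P Q → map (i ∷_) P ++ Q) R.P≡ R′.P≡
    ; head≡weight = R.head≡weight; head≡count = R.head≡count
    ; steps = Steps-++ (Steps-map-∷ i R.steps) (junction ∷ R′.steps)
    ; weight-last = R′.weight-last
    }
    where
    module R = RunsMatch R
    module R′ = RunsMatch R′
    junction : head es + weight (i ∷ R.last) ≡ weight (suc i ∷ R′.first) + 1
    junction = trans (cong (_+ weight (i ∷ R.last)) R′.head≡weight)
      (weight-junction i R′.first R.last 2+i≤m R.weight-last)

  mutual
    runs-match : ∀ t → RunsMatch (runs t) id (paths t)
    runs-match leaf      = RunsMatch-leaf
    runs-match (node cs) = RunsMatch-node (runsV-match 0 cs (cong suc (+-identityʳ m′)))

    runsV-match : ∀ {k} i (cs : Vec (Tree m) (suc k)) → suc k + i ≡ m → RunsMatch (runsV cs) (i ∷_) (pathsV i cs)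
    runsV-match i (c ∷ [])              1+i≡m   = RunsMatch-lastChild i 1+i≡m (runs-match c)
    runsV-match {suc k} i (c ∷ u ∷ ts) 2+k+i≡m =
      RunsMatch-⁺++⁺ i (subst (suc (suc i) ≤_) 2+k+i≡m (s≤s (s≤s (m≤n+m i k))))
        (runs-match c) (runsV-match (suc i) (u ∷ ts) (trans (cong suc (+-suc k i)) 2+k+i≡m))

  length-runs : ∀ t → length (toList (runs t)) ≡ leaves t
  length-runs t = trans (cong suc (Steps-length steps)) (cong length (sym P≡))
    where open RunsMatch (runs-match t)

  head-runs : ∀ t → + head (runs t) ≡ d₁ t
  head-runs t = cong +_ (trans head≡count (cong (λ P → m′ * count 0 (nth [] P 1)) (sym P≡)))
    where open RunsMatch (runs-match t)

  dⱼ≡weight-difference : ∀ t j →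
    dⱼ {m} t j ≡ (+ weight (nth [] (paths t) j) ℤ.- + weight (nth [] (paths t) (j ∸ 1))) ℤ.+ + 1
  dⱼ≡weight-difference t j = cong (ℤ._+ + 1)
    (sumTo-weightedCount (m ∸_) m (nth [] (paths t) j) (nth [] (paths t) (j ∸ 1)))

  nth-runs : ∀ t j → 2 ≤ j → j ≤ leaves t → + nth 0 (toList (runs t)) j ≡ dⱼ t j
  nth-runs t (suc (suc j)) _ j≤n = begin
      + nth 0 (tail (runs t)) (suc j)
    ≡⟨ m+n≡o+1⇒m≡o-n+1 (Steps-nth steps j j<n) ⟩
      (+ weight (nth [] rest (suc j)) ℤ.- + weight (nth [] (first ∷ rest) (suc j))) ℤ.+ + 1
    ≡⟨ cong (λ P → (+ weight (nth [] P (suc (suc j))) ℤ.- + weight (nth [] P (suc j))) ℤ.+ + 1) P≡ ⟨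
      (+ weight (nth [] (paths t) (suc (suc j))) ℤ.- + weight (nth [] (paths t) (suc j))) ℤ.+ + 1
    ≡⟨ dⱼ≡weight-difference t (suc (suc j)) ⟨
      dⱼ t (suc (suc j))
    ∎
    where
    open ≡-Reasoning
    open RunsMatch (runs-match t)
    j<n : j < length (tail (runs t))
    j<n = ≤-pred (subst (suc (suc j) ≤_) (sym (length-runs t)) j≤n)
  nth-runs t (suc zero) (s≤s ()) _

proposition3p7 : (m g : ℕ) → 2 ≤ m → (t : Tree m) → leaves t ≡ m + g * (m ∸ 1) →
    Σ (List ℕ) λ ds →
      (length ds ≡ m + g * (m ∸ 1))
      × (σ t ≡ pathWord ds)
      × (+ (nth 0 ds 1) ≡ d₁ t)
      × ((j : ℕ) → 2 ≤ j → j ≤ m + g * (m ∸ 1) → + (nth 0 ds j) ≡ dⱼ t j)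
proposition3p7 zero     g () _ _
-- The argument only needs m ≥ 1.
proposition3p7 (suc m′) g _  t leaves≡n =
    toList (runs m′ t)
  , trans (length-runs m′ t) leaves≡n
  , σ-runs m′ t
  , head-runs m′ t
  , λ j 2≤j j≤n → nth-runs m′ t j 2≤j (subst (j ≤_) (sym leaves≡n) j≤n)
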